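{- Let $(a_n)_{n\ge1}$, $(b_n)_{n\ge1}$, $(c_n)_{n\ge2}$ be real sequences and let $T=[t_{n,k}]_{n,k\ge0}$ be defined by $t_{0,0}=1$ and $t_{n,k}=a_nt_{n-1,k-1}+b_nt_{n-1,k}+c_nt_{n-2,k-1}$, where $t_{n,k}=0$ unless $n\ge k\ge0$. Let $\overleftarrow{T}=[t_{n,n-k}]_{n,k\ge0}$ and define $$Q:=\Big[\tfrac{(\boldsymbol\alpha_n)!}{(\boldsymbol\alpha_k)!}\cdot\mathrm{I}[n\ge k]\Big]_{n,k\ge0}\begin{bmatrix}1&\\&D(\boldsymbol\beta,\boldsymbol\gamma)\end{bmatrix},\qquad D(\boldsymbol\beta,\boldsymbol\gamma)=\begin{bmatrix}b_1&&&\\c_2&b_2&&\\&c_3&b_3&\\&&\ddots&\ddots\end{bmatrix}.$$ Then $Q$ is the left production matrix of $\overleftarrow{T}$, i.e. $\overleftarrow{T}=Q\begin{bmatrix}I_1&\\&Q\end{bmatrix}\begin{bmatrix}I_2&\\&Q\end{bmatrix}\cdots$.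
   Context: Here $\frac{(\boldsymbol\alpha_n)!}{(\boldsymbol\alpha_k)!}$ for $n\ge k$ denotes the product $a_{k+1}a_{k+2}\cdots a_n$ (equal to $1$ when $n=k$), where $(\boldsymbol\alpha_n)!=a_1\cdots a_n$; $\mathrm{I}[n\ge k]$ is $1$ if $n\ge k$ and $0$ otherwise; $t_{n,n-k}=0$ for $k>n$. $I_k$ is the $k\times k$ identity and the block matrices are block diagonal; the infinite product is well defined since leading principal submatrices of the partial products stabilize. -}

module Defs where

open import Level using (Level)
open import Algebra.Bundles using (CommutativeRing)
open import Data.Nat using (ℕ; zero; suc; _∸_; _≤ᵇ_) renaming (_+_ to _+ℕ_)
open import Data.Bool using (if_then_else_)

module _ {ℓc ℓe : Level} (R : CommutativeRing ℓc ℓe) where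
  open CommutativeRing R using (_+_; _*_; 0#; 1#) renaming (Carrier to A)

  Mat : Set ℓc
  Mat = ℕ → ℕ → A

  sumTo : (ℕ → A) → ℕ → A
  sumTo f zero    = f zero
  sumTo f (suc n) = sumTo f n + f (suc n)

  -- matrix product of lower-triangular infinite matrices:
  -- (M N)_{n,k} = Σ_{l=0}^{n} M_{n,l} N_{l,k}
  -- (exact for lower-triangular M, where M_{n,l} = 0 for l > n)
  mul : Mat → Mat → Mat
  mul M N n k = sumTo (λ l → M n l * N l k) n

  δ : ℕ → ℕ → A
  δ zero    zero    = 1#
  δ zero    (suc _) = 0#
  δ (suc _) zero    = 0#
  δ (suc i) (suc j) = δ i j

  -- the triangle t_{n,k}: t_{0,0} = 1, t_{0,k} = 0 (k ≥ 1),
  -- t_{n,k} = a_n t_{n-1,k-1} + b_n t_{n-1,k} + c_n t_{n-2,k-1}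
  -- with t_{m,j} = 0 whenever m < 0 or j < 0.
  -- a b c are sequences indexed from 1, 1, 2 respectively (other values unused).
  tri : (a b c : ℕ → A) → Mat
  tri a b c zero          zero    = 1#
  tri a b c zero          (suc k) = 0#
  tri a b c (suc n)       zero    = b (suc n) * tri a b c n zero
  tri a b c (suc zero)    (suc k) =
    a 1 * tri a b c zero k + b 1 * tri a b c zero (suc k)
  tri a b c (suc (suc n)) (suc k) =
    a (suc (suc n)) * tri a b c (suc n) k
    + b (suc (suc n)) * tri a b c (suc n) (suc k)
    + c (suc (suc n)) * tri a b c n k

  revTri : (a b c : ℕ → A) → Mat
  revTri a b c n k = if k ≤ᵇ n then tri a b c n (n ∸ k) else 0#

  -- ratio k d = a_{k+1} a_{k+2} ⋯ a_{k+d}  ( = (α_{k+d})! / (α_k)! )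
  ratio : (ℕ → A) → ℕ → ℕ → A
  ratio a k zero    = 1#
  ratio a k (suc d) = ratio a k d * a (k +ℕ suc d)

  Lmat : (ℕ → A) → Mat
  Lmat a n k = if k ≤ᵇ n then ratio a k (n ∸ k) else 0#

  -- D(β,γ): diagonal b_1, b_2, …; subdiagonal c_2, c_3, …  (0-indexed)
  Dmat : (b c : ℕ → A) → Mat
  Dmat b c zero    zero    = b 1
  Dmat b c zero    (suc j) = 0#
  Dmat b c (suc i) zero    = δ i zero * c 2
  Dmat b c (suc i) (suc j) = Dmat (λ m → b (suc m)) (λ m → c (suc m)) i j

  shift1 : Mat → Mat
  shift1 M zero    zero    = 1#
  shift1 M zero    (suc j) = 0#
  shift1 M (suc i) zero    = 0#
  shift1 M (suc i) (suc j) = M i j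

  Qmat : (a b c : ℕ → A) → Mat
  Qmat a b c = mul (Lmat a) (shift1 (Dmat b c))

  blk : ℕ → Mat → Mat
  blk zero    M = M
  blk (suc m) M = shift1 (blk m M)

  partialProd : (a b c : ℕ → A) → ℕ → Mat
  partialProd a b c zero    = Qmat a b c
  partialProd a b c (suc N) = mul (partialProd a b c N) (blk (suc N) (Qmat a b c))

{-# OPTIONS --safe #-}
module Submission where

-- Write Q = L·diag(1,D) and X_N for the N-th partial product.  Associativity and
-- diag(1,M)·diag(1,N) = diag(1,MN) give X_{N+1} = Q·diag(1,X_N), and since Q is lower
-- triangular, row n of Q·diag(1,M) only involves rows < n of M.  Hence X_N agrees on its
-- first N+1 rows with any fixed point P = Q·diag(1,P).  The reversed triangle is such a
-- fixed point: L·W solves y_{m+1} = a_{m+1} y_m + w_{m+1}, and with W = diag(1,D)·diag(1,T⃖)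
-- this recurrence is the defining recurrence of t_{n,k} read along the reversed rows.

open import Defs
open import Level using (Level)
open import Algebra.Bundles using (CommutativeRing)
open import Data.Nat using (ℕ; zero; suc; _≤_; _<_; z≤n; s≤s; s≤s⁻¹; _≤ᵇ_; _∸_) renaming (_+_ to _+ℕ_)
open import Data.Nat.Properties
  using (≤⇒≤ᵇ; ≤ᵇ⇒≤; <⇒≱; ≤-refl; ≤-trans; ≤-<-trans; <-cmp; m≤n⇒m≤1+n; m<n⇒m<1+n;
         m≤n⇒m<n∨m≡n; n<1+n; <-trans; +-∸-assoc; n∸n≡0; +-suc; m+[n∸m]≡n)
open import Data.Bool using (true; false; if_then_else_)
open import Data.Sum using (inj₁; inj₂)
open import Relation.Nullary using (contradiction)
open import Relation.Binary.Definitions using (tri<; tri≈; tri>)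
open import Relation.Binary.PropositionalEquality using (_≡_)
import Relation.Binary.PropositionalEquality as ≡
import Relation.Binary.Reasoning.Setoid as SetoidReasoning
import Algebra.Properties.CommutativeSemigroup as CommutativeSemigroupProperties

if-≤ᵇ-true : ∀ {a} {A : Set a} {k n} {x y : A} → k ≤ n → (if k ≤ᵇ n then x else y) ≡ x
if-≤ᵇ-true {k = k} {n} k≤n with k ≤ᵇ n | ≤⇒≤ᵇ k≤n
... | true | _ = ≡.refl

if-≤ᵇ-false : ∀ {a} {A : Set a} {k n} {x y : A} → n < k → (if k ≤ᵇ n then x else y) ≡ y
if-≤ᵇ-false {k = k} {n} n<k with k ≤ᵇ n | ≤ᵇ⇒≤ k n
... | false | _   = ≡.refl
... | true  | k≤n = contradiction (k≤n _) (<⇒≱ n<k)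

module _ {ℓc ℓe : Level} (R : CommutativeRing ℓc ℓe) where
  open CommutativeRing R hiding (zero) renaming (Carrier to A)
  open SetoidReasoning setoid
  open CommutativeSemigroupProperties +-commutativeSemigroup using (interchange)

  *-≈0ʳ : ∀ x {y} → y ≈ 0# → x * y ≈ 0#
  *-≈0ʳ x y≈0 = trans (*-cong refl y≈0) (zeroʳ x)

  +-≈0 : ∀ {x y} → x ≈ 0# → y ≈ 0# → x + y ≈ 0#
  +-≈0 x≈0 y≈0 = trans (+-cong x≈0 y≈0) (+-identityˡ 0#)

  sumTo-cong : ∀ {f g : ℕ → A} n → (∀ l → l ≤ n → f l ≈ g l) → sumTo R f n ≈ sumTo R g n
  sumTo-cong zero    f≈g = f≈g 0 z≤n
  sumTo-cong (suc n) f≈g = +-cong (sumTo-cong n λ l l≤n → f≈g l (m≤n⇒m≤1+n l≤n)) (f≈g (suc n) ≤-refl)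

  sumTo-zero : ∀ {f : ℕ → A} n → (∀ l → l ≤ n → f l ≈ 0#) → sumTo R f n ≈ 0#
  sumTo-zero zero    f≈0 = f≈0 0 z≤n
  sumTo-zero (suc n) f≈0 = +-≈0 (sumTo-zero n λ l l≤n → f≈0 l (m≤n⇒m≤1+n l≤n)) (f≈0 (suc n) ≤-refl)

  sumTo-head : ∀ (f : ℕ → A) n → sumTo R f (suc n) ≈ f 0 + sumTo R (λ l → f (suc l)) n
  sumTo-head f zero    = refl
  sumTo-head f (suc n) = trans (+-cong (sumTo-head f n) refl) (+-assoc _ _ _)

  sumTo-last : ∀ {f : ℕ → A} n → (∀ l → l < n → f l ≈ 0#) → sumTo R f n ≈ f n
  sumTo-last zero    _   = refl
  sumTo-last (suc n) f≈0 = begin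
    sumTo R _ n + _ ≈⟨ +-cong (sumTo-zero n λ l l≤n → f≈0 l (s≤s l≤n)) refl ⟩
    0# + _          ≈⟨ +-identityˡ _ ⟩
    _               ∎

  sumTo-truncate : ∀ {f : ℕ → A} {j n} → j ≤ n → (∀ l → j < l → f l ≈ 0#) → sumTo R f n ≈ sumTo R f j
  sumTo-truncate {n = zero}  z≤n _ = refl
  sumTo-truncate {n = suc n} j≤n f≈0 with m≤n⇒m<n∨m≡n j≤n
  ... | inj₂ ≡.refl      = refl
  ... | inj₁ (s≤s j≤n′)  =
    trans (+-cong (sumTo-truncate j≤n′ f≈0) (f≈0 (suc n) (s≤s j≤n′))) (+-identityʳ _)

  *-distribˡ-sumTo : ∀ x (f : ℕ → A) n → x * sumTo R f n ≈ sumTo R (λ l → x * f l) n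
  *-distribˡ-sumTo x f zero    = refl
  *-distribˡ-sumTo x f (suc n) = trans (distribˡ x _ _) (+-cong (*-distribˡ-sumTo x f n) refl)

  *-distribʳ-sumTo : ∀ x (f : ℕ → A) n → sumTo R f n * x ≈ sumTo R (λ l → f l * x) n
  *-distribʳ-sumTo x f zero    = refl
  *-distribʳ-sumTo x f (suc n) = trans (distribʳ x _ _) (+-cong (*-distribʳ-sumTo x f n) refl)

  sumTo-+ : ∀ (f g : ℕ → A) n → sumTo R (λ l → f l + g l) n ≈ sumTo R f n + sumTo R g n
  sumTo-+ f g zero    = refl
  sumTo-+ f g (suc n) = trans (+-cong (sumTo-+ f g n) refl) (interchange _ _ _ _)

  sumTo-swap : ∀ (g : ℕ → ℕ → A) m n →
    sumTo R (λ i → sumTo R (g i) n) m ≈ sumTo R (λ j → sumTo R (λ i → g i j) m) n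
  sumTo-swap g zero    n = refl
  sumTo-swap g (suc m) n =
    trans (+-cong (sumTo-swap g m n) refl) (sym (sumTo-+ (λ j → sumTo R (λ i → g i j) m) (g (suc m)) n))

  infix 4 _≋_
  _≋_ : Mat R → Mat R → Set ℓe
  M ≋ N = ∀ i j → M i j ≈ N i j

  Lower : Mat R → Set ℓe
  Lower M = ∀ i j → i < j → M i j ≈ 0#

  mul-congˡ : ∀ {M M′} N → M ≋ M′ → mul R M N ≋ mul R M′ N
  mul-congˡ N M≋M′ n k = sumTo-cong n λ l _ → *-cong (M≋M′ n l) refl

  mul-congʳ : ∀ M {N N′} → N ≋ N′ → mul R M N ≋ mul R M N′
  mul-congʳ M N≋N′ n k = sumTo-cong n λ l _ → *-cong refl (N≋N′ l k)

  -- `mul` only sums up to the row index, so the middle factor must be lower triangular.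
  mul-assoc : ∀ M {N} P → Lower N → mul R (mul R M N) P ≋ mul R M (mul R N P)
  mul-assoc M {N} P N-lower n k = begin
    sumTo R (λ l → sumTo R (λ j → M n j * N j l) n * P l k) n
      ≈⟨ sumTo-cong n (λ l _ → *-distribʳ-sumTo (P l k) (λ j → M n j * N j l) n) ⟩
    sumTo R (λ l → sumTo R (λ j → M n j * N j l * P l k) n) n
      ≈⟨ sumTo-swap (λ l j → M n j * N j l * P l k) n n ⟩
    sumTo R (λ j → sumTo R (λ l → M n j * N j l * P l k) n) n
      ≈⟨ sumTo-cong n (λ j _ → trans (sumTo-cong n λ l _ → *-assoc _ _ _)
                                     (sym (*-distribˡ-sumTo (M n j) (λ l → N j l * P l k) n))) ⟩
    sumTo R (λ j → M n j * sumTo R (λ l → N j l * P l k) n) n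
      ≈⟨ sumTo-cong n (λ j j≤n → *-cong refl (sumTo-truncate j≤n λ l j<l →
                                   trans (*-cong (N-lower j l j<l) refl) (zeroˡ _))) ⟩
    sumTo R (λ j → M n j * sumTo R (λ l → N j l * P l k) j) n ∎

  mul-shift1ˡ-suc : ∀ M (W : Mat R) i j → mul R (shift1 R M) W (suc i) j ≈ mul R M (λ l → W (suc l)) i j
  mul-shift1ˡ-suc M W i j = begin
    mul R (shift1 R M) W (suc i) j               ≈⟨ sumTo-head _ i ⟩
    0# * W 0 j + mul R M (λ l → W (suc l)) i j   ≈⟨ +-cong (zeroˡ _) refl ⟩
    0# + mul R M (λ l → W (suc l)) i j           ≈⟨ +-identityˡ _ ⟩
    mul R M (λ l → W (suc l)) i j                ∎

  shift1-mul : ∀ M N → mul R (shift1 R M) (shift1 R N) ≋ shift1 R (mul R M N)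
  shift1-mul M N zero    zero    = *-identityˡ 1#
  shift1-mul M N zero    (suc j) = *-identityˡ 0#
  shift1-mul M N (suc i) zero    =
    trans (mul-shift1ˡ-suc M (shift1 R N) i 0) (sumTo-zero i λ l _ → zeroʳ _)
  shift1-mul M N (suc i) (suc j) = mul-shift1ˡ-suc M (shift1 R N) i (suc j)

  Lower-mul : ∀ M {N} → Lower N → Lower (mul R M N)
  Lower-mul M N-lower i j i<j = sumTo-zero i λ l l≤i → *-≈0ʳ _ (N-lower l j (≤-<-trans l≤i i<j))

  Lower-shift1 : ∀ {M} → Lower M → Lower (shift1 R M)
  Lower-shift1 M-lower zero    (suc j) _         = refl
  Lower-shift1 M-lower (suc i) (suc j) (s≤s i<j) = M-lower i j i<j

  Lower-blk : ∀ m {M} → Lower M → Lower (blk R m M)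
  Lower-blk zero    M-lower = M-lower
  Lower-blk (suc m) M-lower = Lower-shift1 (Lower-blk m M-lower)

  mul-shift1-row-zero : ∀ {Q} → Lower Q → ∀ M k → Q 0 k ≈ mul R Q (shift1 R M) 0 k
  mul-shift1-row-zero Q-lower M zero    = sym (*-identityʳ _)
  mul-shift1-row-zero Q-lower M (suc k) = trans (Q-lower 0 (suc k) (s≤s z≤n)) (sym (zeroʳ _))

  shift1-rows : ∀ {M M′} n → (∀ l → l < n → ∀ k → M l k ≈ M′ l k) →
    ∀ l → l ≤ n → ∀ k → shift1 R M l k ≈ shift1 R M′ l k
  shift1-rows n M≈M′ zero    _       zero    = refl
  shift1-rows n M≈M′ zero    _       (suc k) = refl
  shift1-rows n M≈M′ (suc l) _       zero    = refl
  shift1-rows n M≈M′ (suc l) 1+l≤n (suc k) = M≈M′ l 1+l≤n k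

  fixed-point-rows : ∀ {Q P} → Lower Q → P ≋ mul R Q (shift1 R P) →
    (X : ℕ → Mat R) → X 0 ≋ Q → (∀ N → X (suc N) ≋ mul R Q (shift1 R (X N))) →
    ∀ {N n} → n ≤ N → ∀ k → X N n k ≈ P n k
  fixed-point-rows {Q} {P} Q-lower P-fixed X X₀ X-suc = rows
    where
    rows : ∀ {N n} → n ≤ N → ∀ k → X N n k ≈ P n k
    rows {zero}  z≤n k = begin
      X 0 0 k                    ≈⟨ X₀ 0 k ⟩
      Q 0 k                      ≈⟨ mul-shift1-row-zero Q-lower P k ⟩
      mul R Q (shift1 R P) 0 k   ≈⟨ P-fixed 0 k ⟨
      P 0 k                      ∎
    rows {suc N} {n} n≤1+N k = begin
      X (suc N) n k                    ≈⟨ X-suc N n k ⟩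
      mul R Q (shift1 R (X N)) n k     ≈⟨ sumTo-cong n (λ l l≤n → *-cong refl (shift1-rows n
                                            (λ l l<n → rows (s≤s⁻¹ (≤-trans l<n n≤1+N))) l l≤n k)) ⟩
      mul R Q (shift1 R P) n k         ≈⟨ P-fixed n k ⟨
      P n k                            ∎

  Dmat-diag : ∀ b c i → Dmat R b c i i ≡ b (suc i)
  Dmat-diag b c zero    = ≡.refl
  Dmat-diag b c (suc i) = Dmat-diag (λ m → b (suc m)) (λ m → c (suc m)) i

  Dmat-sub : ∀ b c i → Dmat R b c (suc i) i ≈ c (suc (suc i))
  Dmat-sub b c zero    = *-identityˡ (c 2)
  Dmat-sub b c (suc i) = Dmat-sub (λ m → b (suc m)) (λ m → c (suc m)) i

  Dmat-far : ∀ b c i j → suc j < i → Dmat R b c i j ≈ 0#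
  Dmat-far b c (suc (suc i)) zero    _         = zeroˡ _
  Dmat-far b c (suc i)       (suc j) (s≤s j<i) = Dmat-far _ _ i j j<i

  Lower-Dmat : ∀ b c → Lower (Dmat R b c)
  Lower-Dmat b c zero    (suc j) _         = refl
  Lower-Dmat b c (suc i) (suc j) (s≤s i<j) = Lower-Dmat _ _ i j i<j

  Dmat-mul-suc : ∀ b c (W : Mat R) m k →
    mul R (Dmat R b c) W (suc m) k ≈ b (suc (suc m)) * W (suc m) k + c (suc (suc m)) * W m k
  Dmat-mul-suc b c W m k = begin
    sumTo R (λ l → Dmat R b c (suc m) l * W l k) m + Dmat R b c (suc m) (suc m) * W (suc m) k
      ≈⟨ +-cong (sumTo-last m λ l l<m → trans (*-cong (Dmat-far b c (suc m) l (s≤s l<m)) refl) (zeroˡ _))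
                (*-cong (reflexive (Dmat-diag b c (suc m))) refl) ⟩
    Dmat R b c (suc m) m * W m k + b (suc (suc m)) * W (suc m) k
      ≈⟨ +-comm _ _ ⟩
    b (suc (suc m)) * W (suc m) k + Dmat R b c (suc m) m * W m k
      ≈⟨ +-cong refl (*-cong (Dmat-sub b c m) refl) ⟩
    b (suc (suc m)) * W (suc m) k + c (suc (suc m)) * W m k ∎

  Lmat-diag : ∀ a m → Lmat R a m m ≈ 1#
  Lmat-diag a m = reflexive (≡.trans (if-≤ᵇ-true (≤-refl {m})) (≡.cong (ratio R a m) (n∸n≡0 m)))

  Lmat-suc : ∀ a {l m} → l ≤ m → Lmat R a (suc m) l ≈ a (suc m) * Lmat R a m l
  Lmat-suc a {l} {m} l≤m = begin
    Lmat R a (suc m) l                              ≡⟨ if-≤ᵇ-true (m≤n⇒m≤1+n l≤m) ⟩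
    ratio R a l (suc m ∸ l)                         ≡⟨ ≡.cong (ratio R a l) (+-∸-assoc 1 l≤m) ⟩
    ratio R a l (m ∸ l) * a (l +ℕ suc (m ∸ l))      ≡⟨ ≡.cong (λ i → ratio R a l (m ∸ l) * a i)
                                                                l+[1+m∸l]≡1+m ⟩
    ratio R a l (m ∸ l) * a (suc m)                 ≈⟨ *-comm _ _ ⟩
    a (suc m) * ratio R a l (m ∸ l)                 ≡⟨ ≡.cong (a (suc m) *_) (if-≤ᵇ-true l≤m) ⟨
    a (suc m) * Lmat R a m l                        ∎
    where
    l+[1+m∸l]≡1+m : l +ℕ suc (m ∸ l) ≡ suc m
    l+[1+m∸l]≡1+m = ≡.trans (+-suc l (m ∸ l)) (≡.cong suc (m+[n∸m]≡n l≤m))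

  Lmat-mul-suc : ∀ a (W : Mat R) m k →
    mul R (Lmat R a) W (suc m) k ≈ a (suc m) * mul R (Lmat R a) W m k + W (suc m) k
  Lmat-mul-suc a W m k = +-cong
    (trans (sumTo-cong m λ l l≤m → trans (*-cong (Lmat-suc a l≤m) refl) (*-assoc _ _ _))
           (sym (*-distribˡ-sumTo (a (suc m)) _ m)))
    (trans (*-cong (Lmat-diag a (suc m)) refl) (*-identityˡ _))

  Lmat-mul-unique : ∀ a (W Y : Mat R) → (∀ k → Y 0 k ≈ W 0 k) →
    (∀ m k → Y (suc m) k ≈ a (suc m) * Y m k + W (suc m) k) → Y ≋ mul R (Lmat R a) W
  Lmat-mul-unique a W Y Y₀ Y-suc zero    k = trans (Y₀ k) (sym (*-identityˡ _))
  Lmat-mul-unique a W Y Y₀ Y-suc (suc m) k = begin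
    Y (suc m) k                                       ≈⟨ Y-suc m k ⟩
    a (suc m) * Y m k + W (suc m) k                   ≈⟨ +-cong (*-cong refl (Lmat-mul-unique a W Y Y₀ Y-suc m k))
                                                                refl ⟩
    a (suc m) * mul R (Lmat R a) W m k + W (suc m) k  ≈⟨ Lmat-mul-suc a W m k ⟨
    mul R (Lmat R a) W (suc m) k                      ∎

  module _ (a b c : ℕ → A) where
    private
      t : Mat R
      t = tri R a b c

      t⃖ : Mat R
      t⃖ = revTri R a b c

    tri-above : ∀ {n k} → n < k → t n k ≈ 0#
    tri-above {zero}        {suc k}       _           = refl
    tri-above {suc zero}    {suc (suc k)} _           = +-≈0 (zeroʳ _) (zeroʳ _)
    tri-above {suc zero}    {suc zero}    (s≤s ())
    tri-above {suc (suc n)} {suc k}       (s≤s 1+n<k) =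
      +-≈0 (+-≈0 (*-≈0ʳ _ (tri-above 1+n<k)) (*-≈0ʳ _ (tri-above (m<n⇒m<1+n 1+n<k))))
           (*-≈0ʳ _ (tri-above (<-trans (n<1+n n) 1+n<k)))

    revTri-≤ : ∀ {n k} → k ≤ n → t⃖ n k ≡ t n (n ∸ k)
    revTri-≤ = if-≤ᵇ-true

    revTri-> : ∀ {n k} → n < k → t⃖ n k ≡ 0#
    revTri-> = if-≤ᵇ-false

    revTri-diag : ∀ n → t⃖ n n ≡ t n 0
    revTri-diag n = ≡.trans (revTri-≤ (≤-refl {n})) (≡.cong (t n) (n∸n≡0 n))

    revTri-suc-zero : ∀ n → t⃖ (suc n) 0 ≈ a (suc n) * t⃖ n 0
    revTri-suc-zero zero    = trans (+-cong refl (zeroʳ _)) (+-identityʳ _)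
    revTri-suc-zero (suc n) = begin
      (a (2 +ℕ n) * t (suc n) (suc n) + b (2 +ℕ n) * t (suc n) (2 +ℕ n)) + c (2 +ℕ n) * t n (suc n)
        ≈⟨ +-assoc _ _ _ ⟩
      a (2 +ℕ n) * t (suc n) (suc n) + (b (2 +ℕ n) * t (suc n) (2 +ℕ n) + c (2 +ℕ n) * t n (suc n))
        ≈⟨ +-cong refl (+-≈0 (*-≈0ʳ _ (tri-above (n<1+n (suc n)))) (*-≈0ʳ _ (tri-above (n<1+n n)))) ⟩
      a (2 +ℕ n) * t (suc n) (suc n) + 0#
        ≈⟨ +-identityʳ _ ⟩
      a (2 +ℕ n) * t (suc n) (suc n) ∎

    revTri-one-suc : ∀ k → t⃖ 1 (suc k) ≈ a 1 * t⃖ 0 (suc k) + b 1 * t⃖ 0 k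
    revTri-one-suc zero    = sym (trans (+-cong (zeroʳ _) refl) (+-identityˡ _))
    revTri-one-suc (suc k) = trans (reflexive (revTri-> {1} {2 +ℕ k} (s≤s (s≤s z≤n))))
      (sym (+-≈0 (*-≈0ʳ _ (reflexive (revTri-> {0} {2 +ℕ k} (s≤s z≤n))))
                 (*-≈0ʳ _ (reflexive (revTri-> {0} {suc k} (s≤s z≤n))))))

    revTri-suc-suc : ∀ n k → t⃖ (2 +ℕ n) (suc k) ≈
      a (2 +ℕ n) * t⃖ (suc n) (suc k) + (b (2 +ℕ n) * t⃖ (suc n) k + c (2 +ℕ n) * t⃖ n k)
    revTri-suc-suc n k with <-cmp k (suc n)
    ... | tri< (s≤s k≤n) _ _ = begin
      t⃖ (2 +ℕ n) (suc k)
        ≡⟨ revTri-≤ (s≤s (m≤n⇒m≤1+n k≤n)) ⟩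
      t (2 +ℕ n) (suc n ∸ k)
        ≡⟨ ≡.cong (t (2 +ℕ n)) 1+n∸k≡1+[n∸k] ⟩
      (a (2 +ℕ n) * t (suc n) (n ∸ k) + b (2 +ℕ n) * t (suc n) (suc (n ∸ k))) + c (2 +ℕ n) * t n (n ∸ k)
        ≈⟨ +-assoc _ _ _ ⟩
      a (2 +ℕ n) * t (suc n) (n ∸ k) + (b (2 +ℕ n) * t (suc n) (suc (n ∸ k)) + c (2 +ℕ n) * t n (n ∸ k))
        ≈⟨ +-cong (*-cong refl (reflexive (revTri-≤ (s≤s k≤n))))
                  (+-cong (*-cong refl (reflexive (≡.trans (revTri-≤ (m≤n⇒m≤1+n k≤n))
                                                           (≡.cong (t (suc n)) 1+n∸k≡1+[n∸k]))))
                          (*-cong refl (reflexive (revTri-≤ k≤n)))) ⟨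
      a (2 +ℕ n) * t⃖ (suc n) (suc k) + (b (2 +ℕ n) * t⃖ (suc n) k + c (2 +ℕ n) * t⃖ n k) ∎
      where
      1+n∸k≡1+[n∸k] : suc n ∸ k ≡ suc (n ∸ k)
      1+n∸k≡1+[n∸k] = +-∸-assoc 1 k≤n
    ... | tri≈ _ ≡.refl _ = begin
      t⃖ (2 +ℕ n) (2 +ℕ n)
        ≡⟨ revTri-diag (2 +ℕ n) ⟩
      b (2 +ℕ n) * t (suc n) 0
        ≈⟨ +-identityʳ _ ⟨
      b (2 +ℕ n) * t (suc n) 0 + 0#
        ≈⟨ +-cong (*-cong refl (reflexive (revTri-diag (suc n)))) (*-≈0ʳ _ (reflexive (revTri-> (n<1+n n)))) ⟨
      b (2 +ℕ n) * t⃖ (suc n) (suc n) + c (2 +ℕ n) * t⃖ n (suc n)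
        ≈⟨ +-identityˡ _ ⟨
      0# + (b (2 +ℕ n) * t⃖ (suc n) (suc n) + c (2 +ℕ n) * t⃖ n (suc n))
        ≈⟨ +-cong (*-≈0ʳ _ (reflexive (revTri-> (n<1+n (suc n))))) refl ⟨
      a (2 +ℕ n) * t⃖ (suc n) (2 +ℕ n) + (b (2 +ℕ n) * t⃖ (suc n) (suc n) + c (2 +ℕ n) * t⃖ n (suc n)) ∎
    ... | tri> _ _ 1+n<k = trans (reflexive (revTri-> (s≤s 1+n<k)))
      (sym (+-≈0 (*-≈0ʳ _ (reflexive (revTri-> (m<n⇒m<1+n 1+n<k))))
                 (+-≈0 (*-≈0ʳ _ (reflexive (revTri-> 1+n<k)))
                       (*-≈0ʳ _ (reflexive (revTri-> (<-trans (n<1+n n) 1+n<k)))))))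

    revTri-suc : ∀ m k →
      t⃖ (suc m) k ≈ a (suc m) * t⃖ m k + mul R (Dmat R b c) (λ l → shift1 R t⃖ (suc l)) m k
    revTri-suc m       zero    =
      trans (revTri-suc-zero m) (sym (trans (+-cong refl (sumTo-zero m λ _ _ → zeroʳ _)) (+-identityʳ _)))
    revTri-suc zero    (suc k) = revTri-one-suc k
    revTri-suc (suc m) (suc k) =
      trans (revTri-suc-suc m k) (+-cong refl (sym (Dmat-mul-suc b c (λ l → shift1 R t⃖ (suc l)) m (suc k))))

    revTri-row-zero : ∀ k → t⃖ 0 k ≈ shift1 R t⃖ 0 k
    revTri-row-zero zero    = refl
    revTri-row-zero (suc k) = reflexive (revTri-> {0} {suc k} (s≤s z≤n))

    Lower-Qmat : Lower (Qmat R a b c)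
    Lower-Qmat = Lower-mul (Lmat R a) (Lower-shift1 (Lower-Dmat b c))

    revTri-fixed-point : t⃖ ≋ mul R (Qmat R a b c) (shift1 R t⃖)
    revTri-fixed-point n k = begin
      t⃖ n k                                 ≈⟨ Lmat-mul-unique a W t⃖ t⃖-zero t⃖-suc n k ⟩
      mul R (Lmat R a) W n k                 ≈⟨ mul-assoc (Lmat R a) (shift1 R t⃖) (Lower-shift1 (Lower-Dmat b c)) n k ⟨
      mul R (Qmat R a b c) (shift1 R t⃖) n k ∎
      where
      W : Mat R
      W = mul R (shift1 R (Dmat R b c)) (shift1 R t⃖)

      t⃖-zero : ∀ k → t⃖ 0 k ≈ W 0 k
      t⃖-zero k = trans (revTri-row-zero k) (sym (*-identityˡ _))

      t⃖-suc : ∀ m k → t⃖ (suc m) k ≈ a (suc m) * t⃖ m k + W (suc m) k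
      t⃖-suc m k = trans (revTri-suc m k) (+-cong refl (sym (mul-shift1ˡ-suc (Dmat R b c) (shift1 R t⃖) m k)))

    Lower-partialProd : ∀ N → Lower (partialProd R a b c N)
    Lower-partialProd zero    = Lower-Qmat
    Lower-partialProd (suc N) = Lower-mul (partialProd R a b c N) (Lower-blk (suc N) Lower-Qmat)

    partialProd-suc : ∀ N → partialProd R a b c (suc N) ≋ mul R (Qmat R a b c) (shift1 R (partialProd R a b c N))
    partialProd-suc zero    _ _ = refl
    partialProd-suc (suc N) n k = begin
      mul R (X (suc N)) (shift1 R B) n k            ≈⟨ mul-congˡ (shift1 R B) (partialProd-suc N) n k ⟩
      mul R (mul R Q (shift1 R (X N))) (shift1 R B) n k
        ≈⟨ mul-assoc Q (shift1 R B) (Lower-shift1 (Lower-partialProd N)) n k ⟩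
      mul R Q (mul R (shift1 R (X N)) (shift1 R B)) n k ≈⟨ mul-congʳ Q (shift1-mul (X N) B) n k ⟩
      mul R Q (shift1 R (X (suc N))) n k             ∎
      where
      Q : Mat R
      Q = Qmat R a b c

      X : ℕ → Mat R
      X = partialProd R a b c

      B : Mat R
      B = blk R (suc N) Q

corollary5p3 : {ℓc ℓe : Level} (R : CommutativeRing ℓc ℓe)
    (a b c : ℕ → CommutativeRing.Carrier R) (n k N : ℕ) → n ≤ N →
    CommutativeRing._≈_ R (partialProd R a b c N n k) (revTri R a b c n k)
corollary5p3 R a b c n k N n≤N =
  fixed-point-rows R (Lower-Qmat R a b c) (revTri-fixed-point R a b c)
    (partialProd R a b c) (λ _ _ → CommutativeRing.refl R) (partialProd-suc R a b c) n≤N k
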